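{- Let $M=\langle W,\{\sim_i,\mathscr{A}_i\}_{i\in\mathcal{G}},V\rangle$ be an epistemic model with awareness and $i\in\mathcal{G}$. Then the EK-accessibility relation $(\sim_i\circ\approx_i)^+$ is an equivalence relation on $W$.
   Context: $\mathcal{P}$ is a countable set of atomic propositions, $\mathcal{G}$ a finite set of agents. An epistemic model with awareness is $M=\langle W,\{\sim_i,\mathscr{A}_i\}_{i\in\mathcal{G}},V\rangle$ where $W\neq\emptyset$, each $\sim_i$ is an equivalence relation on $W$, each $\mathscr{A}_i:W\to 2^{\mathcal{P}}$ satisfies: if $(w,v)\in\sim_i$ then $\mathscr{A}_i(w)=\mathscr{A}_i(v)$, and $V:\mathcal{P}\to 2^W$. The A-equivalence relation $\approx_i$ on $W$: $(w,v)\in\approx_i$ iff $\mathscr{A}_i(w)=\mathscr{A}_i(v)$ and for every $p\in\mathscr{A}_i(w)$, $w\in V(p)$ iff $v\in V(p)$. $\sim_i\circ\approx_i=\{(w,u)\mid\exists t\in W\,((w,t)\in\approx_i\text{ and }(t,u)\in\sim_i)\}$, and $R^+$ denotes the transitive closure of a relation $R$. -}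

module Defs where

open import Level using (0ℓ)
open import Data.Nat using (ℕ)
open import Data.Fin using (Fin)
open import Data.Product using (Σ; ∃; _×_; _,_)
open import Function using (_∘_; Injective)
open import Function.Bundles using (_⇔_)
open import Relation.Binary.Core using (Rel)
open import Relation.Binary.Structures using (IsEquivalence)
open import Relation.Binary.PropositionalEquality using (_≡_)
open import Relation.Binary.Construct.Closure.Transitive using (TransClosure)

Subset : Set → Set₁
Subset X = X → Set

_≐_ : {X : Set} → Subset X → Subset X → Set
A ≐ B = ∀ x → (A x ⇔ B x)

Countable : Set → Set
Countable X = Σ (X → ℕ) (Injective _≡_ _≡_)

record EpistemicAwarenessModel (P : Set) (G : Set) : Set₁ where
  field
    W       : Set
    inhabited : W
    _~[_]_  : W → G → W → Set
    ~-equiv : ∀ i → IsEquivalence (λ w v → w ~[ i ] v)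
    𝒜       : G → W → Subset P
    𝒜-~     : ∀ i {w v} → w ~[ i ] v → 𝒜 i w ≐ 𝒜 i v
    V       : P → Subset W

  _≈[_]_ : W → G → W → Set
  w ≈[ i ] v = (𝒜 i w ≐ 𝒜 i v) × (∀ p → 𝒜 i w p → (V p w ⇔ V p v))

  ∼∘≈ : G → Rel W 0ℓ
  ∼∘≈ i w u = ∃ λ t → (w ≈[ i ] t) × (t ~[ i ] u)

  EK : G → Rel W 0ℓ
  EK i = TransClosure (∼∘≈ i)

{-# OPTIONS --safe #-}
-- A step w ≈ t ∼ u is undone by the two steps u ≈ u ∼ t and t ≈ w ∼ w, using reflexivity and
-- symmetry of both factors; so the transitive closure of the composite of two reflexive,
-- symmetric relations is symmetric, and it is reflexive and transitive anyway.
module Submission where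

open import Defs
open import Level using (Level; _⊔_)
open import Data.Nat using (ℕ)
open import Data.Fin using (Fin)
open import Data.Product using (∃; _×_; _,_)
open import Function.Bundles using (Equivalence)
import Function.Properties.Equivalence as ⇔
open import Relation.Binary.Core using (Rel)
open import Relation.Binary.Definitions using (Reflexive; Symmetric)
open import Relation.Binary.Structures using (IsEquivalence)
open import Relation.Binary.Construct.Closure.Transitive using (TransClosure; [_]; _∷_; _∷ʳ_; _++_)

private
  variable
    a ℓ ℓ₁ ℓ₂ : Level
    A : Set a

_⨾_ : {A : Set a} → Rel A ℓ₁ → Rel A ℓ₂ → Rel A (a ⊔ ℓ₁ ⊔ ℓ₂)
(L ⨾ R) x y = ∃ λ k → L x k × R k y

module _ {_∼_ : Rel A ℓ} where

  symmetric-if-steps-reversible : (∀ {x y} → x ∼ y → TransClosure _∼_ y x) →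
                                  Symmetric (TransClosure _∼_)
  symmetric-if-steps-reversible reverse [ x∼y ]        = reverse x∼y
  symmetric-if-steps-reversible reverse (x∼y ∷ y∼⁺z) =
    symmetric-if-steps-reversible reverse y∼⁺z ++ reverse x∼y

module _ {L : Rel A ℓ₁} {R : Rel A ℓ₂}
         (L-refl : Reflexive L) (L-sym : Symmetric L)
         (R-refl : Reflexive R) (R-sym : Symmetric R) where

  composite-step-reversible : ∀ {x y} → (L ⨾ R) x y → TransClosure (L ⨾ R) y x
  composite-step-reversible {x} {y} (_ , xLk , kRy) =
    [ y , L-refl , R-sym kRy ] ∷ʳ (x , L-sym xLk , R-refl)

  transClosure-composite-isEquivalence : IsEquivalence (TransClosure (L ⨾ R))
  transClosure-composite-isEquivalence = record
    { refl  = [ _ , L-refl , R-refl ]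
    ; sym   = symmetric-if-steps-reversible composite-step-reversible
    ; trans = _++_
    }

module _ {P G : Set} (M : EpistemicAwarenessModel P G) (i : G) where
  open EpistemicAwarenessModel M

  ≈-refl : Reflexive _≈[ i ]_
  ≈-refl = (λ _ → ⇔.refl) , (λ _ _ → ⇔.refl)

  ≈-sym : Symmetric _≈[ i ]_
  ≈-sym (𝒜w≐𝒜v , V-agree) =
    (λ p → ⇔.sym (𝒜w≐𝒜v p)) ,
    (λ p p∈𝒜v → ⇔.sym (V-agree p (Equivalence.from (𝒜w≐𝒜v p) p∈𝒜v)))

  EK-isEquivalence : IsEquivalence (EK i)
  EK-isEquivalence = transClosure-composite-isEquivalence ≈-refl ≈-sym ∼.refl ∼.sym
    where module ∼ = IsEquivalence (~-equiv i)

lemma1 : (P : Set) → Countable P → (n : ℕ) → (M : EpistemicAwarenessModel P (Fin n)) → (i : Fin n) → IsEquivalence (EpistemicAwarenessModel.EK M i)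
lemma1 P _ n M i = EK-isEquivalence M i
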